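{- For each choice of $\sigma\in\{+,-\}$, the sign pattern $\begin{bmatrix}+&-&0\\-&\sigma&+\\0&+&0\end{bmatrix}$ requires algebraic positivity.
   Context: For a sign pattern $S$ (matrix with entries in $\{+,-,0\}$), $Q(S)$ is the set of real matrices $X$ with $\mathrm{sgn}(X_{ij})=S_{ij}$ for all $i,j$. A real square matrix $M$ is algebraically positive if there is a real polynomial $p$ with all entries of $p(M)$ positive. $S$ requires algebraic positivity if every $X\in Q(S)$ is algebraically positive. (The paper writes the $(2,2)$ entry as $*$, meaning it may be either $+$ or $-$.) -}

module Defs where

open import Level using (0ℓ)
open import Data.Nat using (ℕ; zero; suc)
open import Data.Fin using (Fin; zero; suc)
open import Data.Fin.Properties using () renaming (_≟_ to _≟ᶠ_)
open import Data.List using (List; []; _∷_)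
open import Data.Product using (Σ; _×_; _,_)
open import Data.Sum using (_⊎_)
open import Relation.Nullary using (¬_; yes; no)
open import Algebra.Bundles using (CommutativeRing)
open import Relation.Binary.Structures using (IsStrictTotalOrder)

-- The real numbers, axiomatised as a complete ordered field.
-- Any two complete ordered fields are isomorphic, so quantifying over
-- all of them is the same as speaking about ℝ.

record RealField : Set₁ where
  field
    commutativeRing : CommutativeRing 0ℓ 0ℓ
  open CommutativeRing commutativeRing public
  infix 4 _<_ _≤_
  field
    _<_                  : Carrier → Carrier → Set
    <-isStrictTotalOrder : IsStrictTotalOrder _≈_ _<_
    0≉1                  : ¬ (0# ≈ 1#)
    inverse              : ∀ x → ¬ (x ≈ 0#) → Σ Carrier (λ y → x * y ≈ 1#)
    +-monoˡ-<            : ∀ {x y} z → x < y → x + z < y + z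
    *-pos                : ∀ {x y} → 0# < x → 0# < y → 0# < x * y

  _≤_ : Carrier → Carrier → Set
  x ≤ y = x < y ⊎ x ≈ y

  UpperBound : (Carrier → Set) → Carrier → Set
  UpperBound P b = ∀ x → P x → x ≤ b

  field
    sup : (P : Carrier → Set) → Σ Carrier P → Σ Carrier (UpperBound P) →
          Σ Carrier (λ s → UpperBound P s × (∀ b → UpperBound P b → s ≤ b))

data Sign : Set where
  plus minus zer : Sign

SignPattern : ℕ → Set
SignPattern n = Fin n → Fin n → Sign

module _ (R : RealField) where
  open RealField R hiding (zero)

  Mat : ℕ → Set
  Mat n = Fin n → Fin n → Carrier

  sumFin : ∀ {n} → (Fin n → Carrier) → Carrier
  sumFin {zero}  f = 0#
  sumFin {suc n} f = f zero + sumFin (λ i → f (suc i))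

  _*ᴹ_ : ∀ {n} → Mat n → Mat n → Mat n
  (A *ᴹ B) i j = sumFin (λ k → A i k * B k j)

  _+ᴹ_ : ∀ {n} → Mat n → Mat n → Mat n
  (A +ᴹ B) i j = A i j + B i j

  0ᴹ : ∀ {n} → Mat n
  0ᴹ i j = 0#

  scalarᴹ : ∀ {n} → Carrier → Mat n
  scalarᴹ c i j with i ≟ᶠ j
  ... | yes _ = c
  ... | no  _ = 0#

  -- a real polynomial given by its coefficient list c₀ ∷ c₁ ∷ … (c₀ + c₁ x + …),
  -- evaluated at a square matrix (Horner scheme)
  evalPoly : ∀ {n} → List Carrier → Mat n → Mat n
  evalPoly []       M = 0ᴹ
  evalPoly (c ∷ cs) M = scalarᴹ c +ᴹ (M *ᴹ evalPoly cs M)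

  AlgebraicallyPositive : ∀ {n} → Mat n → Set
  AlgebraicallyPositive M = Σ (List Carrier) (λ p → ∀ i j → 0# < evalPoly p M i j)

  HasSign : Sign → Carrier → Set
  HasSign plus  x = 0# < x
  HasSign minus x = x < 0#
  HasSign zer   x = x ≈ 0#

  InQ : ∀ {n} → SignPattern n → Mat n → Set
  InQ S X = ∀ i j → HasSign (S i j) (X i j)

  RequiresAlgebraicPositivity : ∀ {n} → SignPattern n → Set
  RequiresAlgebraicPositivity {n} S = (X : Mat n) → InQ S X → AlgebraicallyPositive X

pattern9 : Sign → SignPattern 3
pattern9 σ zero zero = plus
pattern9 σ zero (suc zero) = minus
pattern9 σ zero (suc (suc zero)) = zer
pattern9 σ (suc zero) zero = minus
pattern9 σ (suc zero) (suc zero) = σ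
pattern9 σ (suc zero) (suc (suc zero)) = plus
pattern9 σ (suc (suc zero)) zero = zer
pattern9 σ (suc (suc zero)) (suc zero) = plus
pattern9 σ (suc (suc zero)) (suc (suc zero)) = zer

module Submission where

-- Every real matrix X = [ a m 0 ; n d e ; 0 f 0 ] with a, e, f > 0 and m, n < 0
-- (and d arbitrary) is algebraically positive, witnessed by the quadratic
--   p(t) = c₀ + c₁ t - 4 t²,  c₀ = 1 + 4mn + 4ef + 4a² + 2d²,  c₁ = 4d + 2a.
-- Writing b = -m, c = -n, a direct computation gives
--   p(X) = [ 1 + 4ef + 2(a+d)²    2ab                     4be
--            2ca                  1 + 3a² + d² + (a+d)²   2ae
--            4cf                  2af                     1 + 4bc + 4a² + 2d² ],
-- whose entries are visibly positive.  Since the (2,2) entry d is unconstrained,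
-- this proves the theorem for every σ at once.

open import Defs
open import Data.Nat as ℕ using (ℕ; zero; suc)
import Data.Nat.Properties as ℕ
open import Data.Fin using (Fin; zero; suc)
open import Data.Fin.Properties using () renaming (_≟_ to _≟ᶠ_)
open import Data.List using (List; []; _∷_; map)
open import Data.Maybe using (Maybe; just; nothing)
open import Data.Product using (_,_) renaming (_×_ to _×ₚ_)
open import Data.Product.Properties using (≡-dec)
open import Data.Sum using (_⊎_; inj₁; inj₂)
open import Data.Empty using (⊥-elim)
open import Data.Vec using ([]; _∷_)
open import Level using (0ℓ)
open import Relation.Nullary using (yes; no)
open import Relation.Binary.Definitions using (tri<; tri≈; tri>)
open import Relation.Binary.Structures using (IsStrictTotalOrder)
open import Relation.Binary.PropositionalEquality as ≡ using (_≡_)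
open import Algebra.Bundles using (CommutativeRing; RawRing)
open import Algebra.Solver.Ring.AlmostCommutativeRing
  using (fromCommutativeRing; _-Raw-AlmostCommutative⟶_)
import Algebra.Properties.Ring
import Algebra.Properties.AbelianGroup
import Algebra.Properties.CommutativeSemigroup
import Algebra.Properties.Semiring.Mult
import Algebra.Solver.Ring
import Relation.Binary.Reasoning.Setoid

-- An integer is a pair (p , q) read as p - q, kept normalised (p = 0 or q = 0)
-- so that equal integers are syntactically equal and hence decidably so.
module IntegerCoefficients {c ℓ} (CR : CommutativeRing c ℓ) where
  open CommutativeRing CR
  open Algebra.Properties.Ring ring using (-‿+-comm; x[y-z]≈xy-xz; [y-z]x≈yx-zx; -0#≈0#)
  open Algebra.Properties.AbelianGroup +-abelianGroup using (⁻¹-anti-homo‿-)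
  open Algebra.Properties.CommutativeSemigroup +-commutativeSemigroup using (interchange)
  open Algebra.Properties.Semiring.Mult semiring using (_×_; ×-homo-+; ×1-homo-*)
  open Relation.Binary.Reasoning.Setoid setoid

  Difference : Set
  Difference = ℕ ×ₚ ℕ

  canonical : ℕ → ℕ → Difference
  canonical p q = (p ℕ.∸ q , q ℕ.∸ p)

  integers : RawRing 0ℓ 0ℓ
  integers = record
    { Carrier = Difference
    ; _≈_ = ≡._≡_
    ; _+_ = λ { (p , q) (r , s) → canonical (p ℕ.+ r) (q ℕ.+ s) }
    ; _*_ = λ { (p , q) (r , s) → canonical (p ℕ.* r ℕ.+ q ℕ.* s) (p ℕ.* s ℕ.+ q ℕ.* r) }
    ; -_ = λ { (p , q) → (q , p) }
    ; 0# = (0 , 0)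
    ; 1# = (1 , 0)
    }

  ⟦_⟧ᶻ : Difference → Carrier
  ⟦ p , q ⟧ᶻ = p × 1# - q × 1#

  -[+]-cancelˡ : ∀ z x y → (z + x) - (z + y) ≈ x - y
  -[+]-cancelˡ z x y = begin
    (z + x) + - (z + y)   ≈⟨ +-congˡ (-‿+-comm z y) ⟨
    (z + x) + (- z + - y) ≈⟨ interchange z x (- z) (- y) ⟩
    (z - z) + (x - y)     ≈⟨ +-congʳ (-‿inverseʳ z) ⟩
    0# + (x - y)          ≈⟨ +-identityˡ (x - y) ⟩
    x - y                 ∎

  -[+]-distrib : ∀ p q r s → (p + r) - (q + s) ≈ (p - q) + (r - s)
  -[+]-distrib p q r s = begin
    (p + r) + - (q + s)   ≈⟨ +-congˡ (-‿+-comm q s) ⟨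
    (p + r) + (- q + - s) ≈⟨ interchange p r (- q) (- s) ⟩
    (p - q) + (r - s)     ∎

  -[*]-distrib : ∀ p q r s → (p * r + q * s) - (p * s + q * r) ≈ (p - q) * (r - s)
  -[*]-distrib p q r s = begin
    (p * r + q * s) + - (p * s + q * r)        ≈⟨ +-congˡ (-‿+-comm _ _) ⟨
    (p * r + q * s) + (- (p * s) + - (q * r))  ≈⟨ interchange _ _ _ _ ⟩
    (p * r - p * s) + (q * s - q * r)          ≈⟨ +-congˡ (⁻¹-anti-homo‿- (q * r) (q * s)) ⟨
    (p * r - p * s) - (q * r - q * s)          ≈⟨ +-cong (x[y-z]≈xy-xz p r s) (-‿cong (x[y-z]≈xy-xz q r s)) ⟨
    p * (r - s) - q * (r - s)                  ≈⟨ [y-z]x≈yx-zx (r - s) p q ⟨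
    (p - q) * (r - s)                          ∎

  ⟦canonical⟧ : ∀ p q → ⟦ canonical p q ⟧ᶻ ≈ ⟦ p , q ⟧ᶻ
  ⟦canonical⟧ zero    zero    = refl
  ⟦canonical⟧ zero    (suc q) = refl
  ⟦canonical⟧ (suc p) zero    = refl
  ⟦canonical⟧ (suc p) (suc q) = trans (⟦canonical⟧ p q) (sym (-[+]-cancelˡ 1# (p × 1#) (q × 1#)))

  ⟦0⟧ : ⟦ 0 , 0 ⟧ᶻ ≈ 0#
  ⟦0⟧ = -‿inverseʳ 0#

  ⟦1⟧ : ⟦ 1 , 0 ⟧ᶻ ≈ 1#
  ⟦1⟧ = begin
    (1# + 0#) - 0# ≈⟨ +-cong (+-identityʳ 1#) -0#≈0# ⟩
    1# + 0#        ≈⟨ +-identityʳ 1# ⟩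
    1#             ∎

  ×1-homo-+* : ∀ p q r s → (p ℕ.* r ℕ.+ q ℕ.* s) × 1# ≈ (p × 1#) * (r × 1#) + (q × 1#) * (s × 1#)
  ×1-homo-+* p q r s = trans (×-homo-+ 1# (p ℕ.* r) (q ℕ.* s)) (+-cong (×1-homo-* p r) (×1-homo-* q s))

  ⟦⟧ᶻ-morphism : integers -Raw-AlmostCommutative⟶ fromCommutativeRing CR
  ⟦⟧ᶻ-morphism = record
    { ⟦_⟧ = ⟦_⟧ᶻ
    ; +-homo = λ { (p , q) (r , s) → begin
        ⟦ canonical (p ℕ.+ r) (q ℕ.+ s) ⟧ᶻ       ≈⟨ ⟦canonical⟧ (p ℕ.+ r) (q ℕ.+ s) ⟩
        (p ℕ.+ r) × 1# - (q ℕ.+ s) × 1#         ≈⟨ +-cong (×-homo-+ 1# p r) (-‿cong (×-homo-+ 1# q s)) ⟩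
        (p × 1# + r × 1#) - (q × 1# + s × 1#)   ≈⟨ -[+]-distrib _ _ _ _ ⟩
        ⟦ p , q ⟧ᶻ + ⟦ r , s ⟧ᶻ                 ∎ }
    ; *-homo = λ { (p , q) (r , s) → begin
        ⟦ canonical (p ℕ.* r ℕ.+ q ℕ.* s) (p ℕ.* s ℕ.+ q ℕ.* r) ⟧ᶻ
          ≈⟨ ⟦canonical⟧ (p ℕ.* r ℕ.+ q ℕ.* s) (p ℕ.* s ℕ.+ q ℕ.* r) ⟩
        (p ℕ.* r ℕ.+ q ℕ.* s) × 1# - (p ℕ.* s ℕ.+ q ℕ.* r) × 1#
          ≈⟨ +-cong (×1-homo-+* p q r s) (-‿cong (×1-homo-+* p q s r)) ⟩
        ((p × 1#) * (r × 1#) + (q × 1#) * (s × 1#)) - ((p × 1#) * (s × 1#) + (q × 1#) * (r × 1#))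
          ≈⟨ -[*]-distrib _ _ _ _ ⟩
        ⟦ p , q ⟧ᶻ * ⟦ r , s ⟧ᶻ
          ∎ }
    ; -‿homo = λ { (p , q) → sym (⁻¹-anti-homo‿- (p × 1#) (q × 1#)) }
    ; 0-homo = ⟦0⟧
    ; 1-homo = ⟦1⟧
    }

  ⟦⟧ᶻ-equal? : ∀ x y → Maybe (⟦ x ⟧ᶻ ≈ ⟦ y ⟧ᶻ)
  ⟦⟧ᶻ-equal? x y with ≡-dec ℕ._≟_ ℕ._≟_ x y
  ... | yes ≡.refl = just refl
  ... | no _       = nothing

  open Algebra.Solver.Ring integers (fromCommutativeRing CR) ⟦⟧ᶻ-morphism ⟦⟧ᶻ-equal? public
    using (Polynomial; con; var; _:+_; _:*_; :-_; _:×_; Env; ⟦_⟧; ⟦_⟧↓; prove)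

module OrderedField (R : RealField) where
  open RealField R hiding (zero)
  open Algebra.Properties.Ring ring using (-‿distribˡ-*; -‿distribʳ-*; -‿involutive)
  open IsStrictTotalOrder <-isStrictTotalOrder public using (<-respʳ-≈; <-respˡ-≈)
  private module < = IsStrictTotalOrder <-isStrictTotalOrder

  neg-pos : ∀ {x} → x < 0# → 0# < - x
  neg-pos {x} x<0 = <-respˡ-≈ (-‿inverseʳ x) (<-respʳ-≈ (+-identityˡ (- x)) (+-monoˡ-< (- x) x<0))

  -[x]*-[x] : ∀ x → - x * - x ≈ x * x
  -[x]*-[x] x = trans (sym (-‿distribˡ-* x (- x))) (trans (-‿cong (sym (-‿distribʳ-* x x))) (-‿involutive _))

  square-nonneg : ∀ x → 0# ≤ x * x
  square-nonneg x with <.compare 0# x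
  ... | tri< 0<x _ _ = inj₁ (*-pos 0<x 0<x)
  ... | tri≈ _ 0≈x _ = inj₂ (sym (trans (*-congʳ (sym 0≈x)) (zeroˡ x)))
  ... | tri> _ _ x<0 = inj₁ (<-respʳ-≈ (-[x]*-[x] x) (*-pos (neg-pos x<0) (neg-pos x<0)))

  -- 1 is positive: 0 ≉ 1, and 1 < 0 would make 1 = (-1)(-1) positive.
  1-pos : 0# < 1#
  1-pos with <.compare 0# 1#
  ... | tri< 0<1 _ _ = 0<1
  ... | tri≈ _ 0≈1 _ = ⊥-elim (0≉1 0≈1)
  ... | tri> _ _ 1<0 = ⊥-elim (<.irrefl refl (<.trans 0<1 1<0))
    where
    0<1 : 0# < 1#
    0<1 = <-respʳ-≈ (trans (-[x]*-[x] 1#) (*-identityˡ 1#)) (*-pos (neg-pos 1<0) (neg-pos 1<0))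

  pos+nonneg : ∀ {x y} → 0# < x → 0# ≤ y → 0# < x + y
  pos+nonneg {x} {y} 0<x (inj₁ 0<y) = <.trans 0<y (<-respˡ-≈ (+-identityˡ y) (+-monoˡ-< y 0<x))
  pos+nonneg {x} {y} 0<x (inj₂ 0≈y) = <-respˡ-≈ (trans (+-identityˡ y) (sym 0≈y)) (+-monoˡ-< y 0<x)

  nonneg+nonneg : ∀ {x y} → 0# ≤ x → 0# ≤ y → 0# ≤ x + y
  nonneg+nonneg         (inj₁ 0<x) 0≤y        = inj₁ (pos+nonneg 0<x 0≤y)
  nonneg+nonneg {x} {y} (inj₂ 0≈x) (inj₁ 0<y) = inj₁ (<-respʳ-≈ (+-comm y x) (pos+nonneg 0<y (inj₂ 0≈x)))
  nonneg+nonneg         (inj₂ 0≈x) (inj₂ 0≈y) = inj₂ (trans (sym (+-identityˡ 0#)) (+-cong 0≈x 0≈y))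

module Expressions (R : RealField) where
  open RealField R hiding (zero)
  open IntegerCoefficients commutativeRing public
  open OrderedField R

  MatE : ℕ → ℕ → Set
  MatE k n = Fin n → Fin n → Polynomial k

  0ₑ : ∀ {k} → Polynomial k
  0ₑ = con (0 , 0)

  sumE : ∀ {k n} → (Fin n → Polynomial k) → Polynomial k
  sumE {n = zero}  f = 0ₑ
  sumE {n = suc n} f = f zero :+ sumE (λ i → f (suc i))

  _*ᴱ_ : ∀ {k n} → MatE k n → MatE k n → MatE k n
  (A *ᴱ B) i j = sumE (λ l → A i l :* B l j)

  scalarE : ∀ {k n} → Polynomial k → MatE k n
  scalarE c i j with i ≟ᶠ j
  ... | yes _ = c
  ... | no  _ = 0ₑ

  evalPolyE : ∀ {k n} → List (Polynomial k) → MatE k n → MatE k n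
  evalPolyE []       M i j = 0ₑ
  evalPolyE (c ∷ cs) M i j = scalarE c i j :+ (M *ᴱ evalPolyE cs M) i j

  _≈ᴹ_ : ∀ {n} → Mat R n → Mat R n → Set
  A ≈ᴹ B = ∀ i j → A i j ≈ B i j

  ⟦_⟧ᴹ : ∀ {k n} → MatE k n → Env k → Mat R n
  ⟦ A ⟧ᴹ ρ i j = ⟦ A i j ⟧ ρ

  module _ {k} (ρ : Env k) where

    ⟦sumE⟧ : ∀ {n} (f : Fin n → Polynomial k) (g : Fin n → Carrier) →
             (∀ l → ⟦ f l ⟧ ρ ≈ g l) → ⟦ sumE f ⟧ ρ ≈ sumFin R g
    ⟦sumE⟧ {zero}  f g f≈g = ⟦0⟧
    ⟦sumE⟧ {suc n} f g f≈g = +-cong (f≈g zero) (⟦sumE⟧ (λ i → f (suc i)) (λ i → g (suc i)) (λ l → f≈g (suc l)))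

    ⟦scalarE⟧ : ∀ {n} (c : Polynomial k) → ⟦ scalarE {n = n} c ⟧ᴹ ρ ≈ᴹ scalarᴹ R (⟦ c ⟧ ρ)
    ⟦scalarE⟧ c i j with i ≟ᶠ j
    ... | yes _ = refl
    ... | no  _ = ⟦0⟧

    -- Semantics commutes with polynomial evaluation; the target matrix M' only
    -- has to agree with ⟦ M ⟧ᴹ entrywise (e.g. structural zeros of a pattern).
    ⟦evalPolyE⟧ : ∀ {n} (cs : List (Polynomial k)) (M : MatE k n) (M' : Mat R n) →
                  ⟦ M ⟧ᴹ ρ ≈ᴹ M' → ⟦ evalPolyE cs M ⟧ᴹ ρ ≈ᴹ evalPoly R (map (λ c → ⟦ c ⟧ ρ) cs) M'
    ⟦evalPolyE⟧ []       M M' M≈M' i j = ⟦0⟧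
    ⟦evalPolyE⟧ (c ∷ cs) M M' M≈M' i j =
      +-cong (⟦scalarE⟧ c i j)
             (⟦sumE⟧ _ _ (λ l → *-cong (M≈M' i l) (⟦evalPolyE⟧ cs M M' M≈M' l j)))

    ×-nonneg : ∀ m (p : Polynomial k) → 0# ≤ ⟦ p ⟧ ρ → 0# ≤ ⟦ m :× p ⟧ ρ
    ×-nonneg zero    p 0≤p = inj₂ (sym ⟦0⟧)
    ×-nonneg (suc m) p 0≤p = nonneg+nonneg 0≤p (×-nonneg m p 0≤p)

    ×-pos : ∀ m (p : Polynomial k) → 0# < ⟦ p ⟧ ρ → 0# < ⟦ suc m :× p ⟧ ρ
    ×-pos m p 0<p = pos+nonneg 0<p (×-nonneg m p (inj₁ 0<p))

    one-pos : 0# < ⟦ con (1 , 0) ⟧ ρ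
    one-pos = <-respʳ-≈ (sym ⟦1⟧) 1-pos

module Certificate (R : RealField) (X : Mat R 3) where
  open RealField R hiding (zero)
  open Expressions R public
  open OrderedField R

  a m n d e f b c one : Polynomial 6
  a = var zero
  m = var (suc zero)
  n = var (suc (suc zero))
  d = var (suc (suc (suc zero)))
  e = var (suc (suc (suc (suc zero))))
  f = var (suc (suc (suc (suc (suc zero)))))
  b = :- m
  c = :- n
  one = con (1 , 0)

  ρ : Env 6
  ρ = X zero zero ∷ X zero (suc zero) ∷ X (suc zero) zero ∷ X (suc zero) (suc zero)
    ∷ X (suc zero) (suc (suc zero)) ∷ X (suc (suc zero)) (suc zero) ∷ []

  Y : MatE 6 3
  Y zero             zero             = a
  Y zero             (suc zero)       = m
  Y zero             (suc (suc zero)) = 0ₑ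
  Y (suc zero)       zero             = n
  Y (suc zero)       (suc zero)       = d
  Y (suc zero)       (suc (suc zero)) = e
  Y (suc (suc zero)) zero             = 0ₑ
  Y (suc (suc zero)) (suc zero)       = f
  Y (suc (suc zero)) (suc (suc zero)) = 0ₑ

  p : List (Polynomial 6)
  p = (one :+ 4 :× (m :* n) :+ 4 :× (e :* f) :+ 4 :× (a :* a) :+ 2 :× (d :* d))
    ∷ (4 :× d :+ 2 :× a)
    ∷ (:- (4 :× one))
    ∷ []

  -- p(Y), rewritten as sums of manifestly positive or nonnegative terms.
  T : MatE 6 3
  T zero             zero             = one :+ 4 :× (e :* f) :+ 2 :× ((a :+ d) :* (a :+ d))
  T zero             (suc zero)       = 2 :× (a :* b)
  T zero             (suc (suc zero)) = 4 :× (b :* e)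
  T (suc zero)       zero             = 2 :× (c :* a)
  T (suc zero)       (suc zero)       = one :+ 3 :× (a :* a) :+ d :* d :+ (a :+ d) :* (a :+ d)
  T (suc zero)       (suc (suc zero)) = 2 :× (a :* e)
  T (suc (suc zero)) zero             = 4 :× (c :* f)
  T (suc (suc zero)) (suc zero)       = 2 :× (a :* f)
  T (suc (suc zero)) (suc (suc zero)) = one :+ 4 :× (b :* c) :+ 4 :× (a :* a) :+ 2 :× (d :* d)

  p[Y]≈T : ∀ i j → ⟦ evalPolyE p Y i j ⟧ ρ ≈ ⟦ T i j ⟧ ρ
  p[Y]≈T i j = prove ρ (evalPolyE p Y i j) (T i j) (same-normal-form i j)
    where
    same-normal-form : ∀ i j → ⟦ evalPolyE p Y i j ⟧↓ ρ ≈ ⟦ T i j ⟧↓ ρ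
    same-normal-form zero             zero             = refl
    same-normal-form zero             (suc zero)       = refl
    same-normal-form zero             (suc (suc zero)) = refl
    same-normal-form (suc zero)       zero             = refl
    same-normal-form (suc zero)       (suc zero)       = refl
    same-normal-form (suc zero)       (suc (suc zero)) = refl
    same-normal-form (suc (suc zero)) zero             = refl
    same-normal-form (suc (suc zero)) (suc zero)       = refl
    same-normal-form (suc (suc zero)) (suc (suc zero)) = refl

  module _ {σ : Sign} (X∈Q : InQ R (pattern9 σ) X) where
    Y≈X : ⟦ Y ⟧ᴹ ρ ≈ᴹ X
    Y≈X zero             zero             = refl
    Y≈X zero             (suc zero)       = refl
    Y≈X zero             (suc (suc zero)) = trans ⟦0⟧ (sym (X∈Q zero (suc (suc zero))))
    Y≈X (suc zero)       zero             = refl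
    Y≈X (suc zero)       (suc zero)       = refl
    Y≈X (suc zero)       (suc (suc zero)) = refl
    Y≈X (suc (suc zero)) zero             = trans ⟦0⟧ (sym (X∈Q (suc (suc zero)) zero))
    Y≈X (suc (suc zero)) (suc zero)       = refl
    Y≈X (suc (suc zero)) (suc (suc zero)) = trans ⟦0⟧ (sym (X∈Q (suc (suc zero)) (suc (suc zero))))

    private
      0<a : 0# < ⟦ a ⟧ ρ
      0<a = X∈Q zero zero
      0<b : 0# < ⟦ b ⟧ ρ
      0<b = neg-pos (X∈Q zero (suc zero))
      0<c : 0# < ⟦ c ⟧ ρ
      0<c = neg-pos (X∈Q (suc zero) zero)
      0<e : 0# < ⟦ e ⟧ ρ
      0<e = X∈Q (suc zero) (suc (suc zero))
      0<f : 0# < ⟦ f ⟧ ρ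
      0<f = X∈Q (suc (suc zero)) (suc zero)

    T-pos : ∀ i j → 0# < ⟦ T i j ⟧ ρ
    T-pos zero             zero             =
      pos+nonneg (pos+nonneg (one-pos ρ) (×-nonneg ρ 4 (e :* f) (inj₁ (*-pos 0<e 0<f))))
                 (×-nonneg ρ 2 ((a :+ d) :* (a :+ d)) (square-nonneg _))
    T-pos zero             (suc zero)       = ×-pos ρ 1 (a :* b) (*-pos 0<a 0<b)
    T-pos zero             (suc (suc zero)) = ×-pos ρ 3 (b :* e) (*-pos 0<b 0<e)
    T-pos (suc zero)       zero             = ×-pos ρ 1 (c :* a) (*-pos 0<c 0<a)
    T-pos (suc zero)       (suc zero)       =
      pos+nonneg (pos+nonneg (pos+nonneg (one-pos ρ) (×-nonneg ρ 3 (a :* a) (square-nonneg _)))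
                             (square-nonneg _))
                 (square-nonneg _)
    T-pos (suc zero)       (suc (suc zero)) = ×-pos ρ 1 (a :* e) (*-pos 0<a 0<e)
    T-pos (suc (suc zero)) zero             = ×-pos ρ 3 (c :* f) (*-pos 0<c 0<f)
    T-pos (suc (suc zero)) (suc zero)       = ×-pos ρ 1 (a :* f) (*-pos 0<a 0<f)
    T-pos (suc (suc zero)) (suc (suc zero)) =
      pos+nonneg (pos+nonneg (pos+nonneg (one-pos ρ) (×-nonneg ρ 4 (b :* c) (inj₁ (*-pos 0<b 0<c))))
                             (×-nonneg ρ 4 (a :* a) (square-nonneg _)))
                 (×-nonneg ρ 2 (d :* d) (square-nonneg _))

mainTheorem9 : (R : RealField) (σ : Sign) → σ ≡ plus ⊎ σ ≡ minus →
    RequiresAlgebraicPositivity R (pattern9 σ)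
mainTheorem9 R σ _ X X∈Q = map (λ cᵢ → ⟦ cᵢ ⟧ ρ) p , p[X]-pos
  where
  open RealField R using (_≈_; _<_; 0#; sym; trans)
  open OrderedField R using (<-respʳ-≈)
  open Certificate R X

  p[X]≈T : ∀ i j → ⟦ T i j ⟧ ρ ≈ evalPoly R (map (λ cᵢ → ⟦ cᵢ ⟧ ρ) p) X i j
  p[X]≈T i j = trans (sym (p[Y]≈T i j)) (⟦evalPolyE⟧ ρ p Y X (Y≈X X∈Q) i j)

  p[X]-pos : ∀ i j → 0# < evalPoly R (map (λ cᵢ → ⟦ cᵢ ⟧ ρ) p) X i j
  p[X]-pos i j = <-respʳ-≈ (p[X]≈T i j) (T-pos X∈Q i j)
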